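{- Let $\mathcal{G}$ be a family of bipartite graphs on a fixed finite vertex set $V$ with a fixed bipartition $(X,Y)$ such that for every $G'\in\mathcal{G}$ and all $u,v\in X$ the compression $G'_{u\to v}$ also belongs to $\mathcal{G}$. Suppose $G\in\mathcal{G}$ satisfies $d_2(G)=\max\{d_2(G'):G'\in\mathcal{G}\}$. Then $G$ is threshold bipartite.
   Context: For a graph $G$ and vertices $x,y$, let $N_G(x,\overline{y})=\{w\in V(G)\setminus\{x,y\}: w\sim x,\ w\not\sim y\}$. The compression $G_{x\to y}$ is the graph obtained from $G$ by deleting all edges between $x$ and $N_G(x,\overline{y})$ and adding all edges from $y$ to $N_G(x,\overline{y})$. $d_2(G)=\sum_{w\in V(G)} d(w)^2$. A graph $G$ is threshold bipartite if there exist $t\in\mathbb{R}$ and $w:V(G)\to\mathbb{R}$ with $|w(v)|<t$ for all $v$ such that distinct vertices $u,v$ are adjacent iff $|w(u)-w(v)|\ge t$ (equivalently, $G$ is bipartite and the neighborhoods of the vertices in one of the parts are linearly ordered by inclusion). -}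

module Defs where

open import Data.Nat using (ℕ; _*_; _≤_)
open import Data.Bool using (Bool; true; false; _∧_; _∨_; not; if_then_else_)
open import Data.Fin using (Fin; _≟_)
open import Data.List using (List; map; allFin)
open import Data.Nat.ListAction using (sum)
open import Data.Product using (Σ; _×_)
open import Data.Sum using (_⊎_)
open import Relation.Nullary using (¬_)
open import Relation.Nullary.Decidable using (⌊_⌋)
open import Relation.Binary.PropositionalEquality using (_≡_)

Graph : ℕ → Set
Graph n = Fin n → Fin n → Bool

IsSimple : {n : ℕ} → Graph n → Set
IsSimple {n} G = (∀ (u v : Fin n) → G u v ≡ G v u) × (∀ (u : Fin n) → G u u ≡ false)

-- A bipartition (X, Y) of V is encoded by X : Fin n → Bool (X = true-side, Y = false-side).
-- Every edge of G goes between X and Y.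
EdgesCross : {n : ℕ} → (Fin n → Bool) → Graph n → Set
EdgesCross {n} X G = ∀ (u v : Fin n) → G u v ≡ true → ¬ (X u ≡ X v)

BipartiteWith : {n : ℕ} → (Fin n → Bool) → Graph n → Set
BipartiteWith X G = IsSimple G × EdgesCross X G

_==_ : {n : ℕ} → Fin n → Fin n → Bool
a == b = ⌊ a ≟ b ⌋

inN : {n : ℕ} → Graph n → Fin n → Fin n → Fin n → Bool
inN G x y w = not (w == x) ∧ not (w == y) ∧ G x w ∧ not (G y w)

-- The compression G_{x→y}: delete the edges between x and N_G(x,ȳ),
-- add all edges from y to N_G(x,ȳ).
compress : {n : ℕ} → Graph n → Fin n → Fin n → Graph n
compress G x y a b =
  if ((a == x) ∧ inN G x y b) ∨ ((b == x) ∧ inN G x y a) then false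
  else if ((a == y) ∧ inN G x y b) ∨ ((b == y) ∧ inN G x y a) then true
  else G a b

deg : {n : ℕ} → Graph n → Fin n → ℕ
deg {n} G w = sum (map (λ v → if G w v then 1 else 0) (allFin n))

d2 : {n : ℕ} → Graph n → ℕ
d2 {n} G = sum (map (λ w → deg G w * deg G w) (allFin n))

NbhdSub : {n : ℕ} → Graph n → Fin n → Fin n → Set
NbhdSub {n} G u v = ∀ (w : Fin n) → G u w ≡ true → G v w ≡ true

-- Threshold bipartite (combinatorial form from the paper's definition):
-- G is bipartite with some bipartition, and the neighbourhoods of the vertices
-- in one of its parts (the `true` side P; swapping P covers the other part)
-- are linearly ordered by inclusion.
ThresholdBipartite : {n : ℕ} → Graph n → Set
ThresholdBipartite {n} G =
  Σ (Fin n → Bool) λ P →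
    EdgesCross P G ×
    (∀ (u v : Fin n) → P u ≡ true → P v ≡ true → NbhdSub G u v ⊎ NbhdSub G v u)

-- If two vertices u, v of X had incomparable neighbourhoods, say with d(u) ≤ d(v), then
-- N(u, v̄) is nonempty and the compression G_{u→v} moves its k ≥ 1 edges from u to v:
-- d(u) drops by k, d(v) grows by k, and every other degree is unchanged (a vertex of N(u, v̄)
-- merely trades u for v as a neighbour).  So d₂ grows by 2k(d(v) − d(u) + k) > 0,
-- contradicting the maximality of d₂(G) in the compression-closed family.
module Submission where

open import Defs
open import Data.Nat using (ℕ; zero; suc; _+_; _*_; _≤_; _<_; z≤n; s≤s)
open import Data.Nat.Properties
  using (+-0-commutativeMonoid; +-identityʳ; +-assoc; +-cancelʳ-<; +-monoʳ-<; ≤-trans; m≤m+n; m≤n+m; m<m+n; <⇒≱; <-asym; ≰⇒>; m≤n⇒∃[o]m+o≡n)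
open import Data.Nat.Solver using (module +-*-Solver)
open import Data.Nat.ListAction using (sum)
open import Data.Bool using (Bool; true; false; _∧_; if_then_else_)
open import Data.Bool.Properties using (∧-zeroʳ; ∧-identityʳ; ∨-identityʳ) renaming (_≟_ to _≟ᵇ_)
open import Data.Fin using (Fin; zero; suc; _≟_)
open import Data.Fin.Properties using (any?; suc-injective)
open import Data.Fin.Permutation using (transpose; _⟨$⟩ʳ_)
open import Data.List using (map; tabulate)
open import Data.Product using (Σ; ∃; _×_; _,_; proj₁; proj₂)
open import Data.Sum using (_⊎_; inj₁; inj₂)
open import Data.Vec.Functional using (updateAt)
open import Data.Vec.Functional.Properties using (updateAt-updates; updateAt-minimal)
open import Function using (_∘_; const)
open import Relation.Nullary using (yes; no; contradiction)
open import Relation.Nullary.Decidable using (_×-dec_)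
open import Relation.Binary.PropositionalEquality
  using (_≡_; _≢_; refl; sym; trans; cong; cong₂; subst; subst₂; module ≡-Reasoning)

open import Algebra.Properties.CommutativeMonoid.Sum +-0-commutativeMonoid
  using (sum-syntax; ∑-distrib-+; ∑-permute; sum-cong-≗) renaming (sum to ∑)

open +-*-Solver using (solve; _:=_; _:+_; _:*_; con)

𝟙 : Bool → ℕ
𝟙 b = if b then 1 else 0

sum-map-tabulate : ∀ {A : Set} n (f : A → ℕ) (g : Fin n → A) → sum (map f (tabulate g)) ≡ ∑[ i < n ] f (g i)
sum-map-tabulate zero    f g = refl
sum-map-tabulate (suc n) f g = cong (f (g zero) +_) (sum-map-tabulate n f (g ∘ suc))

term≤∑ : ∀ {n} (f : Fin n → ℕ) (i : Fin n) → f i ≤ ∑ f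
term≤∑ f zero    = m≤m+n (f zero) _
term≤∑ f (suc i) = ≤-trans (term≤∑ (f ∘ suc) i) (m≤n+m _ (f zero))

∑-exchange : ∀ {n} (u : Fin n) (f g : Fin n → ℕ) → (∀ w → w ≢ u → f w ≡ g w) → ∑ f + g u ≡ ∑ g + f u
∑-exchange zero f g f≗g = begin
  f zero + ∑ (f ∘ suc) + g zero  ≡⟨ cong (λ s → f zero + s + g zero) (sum-cong-≗ (λ i → f≗g (suc i) λ ())) ⟩
  f zero + ∑ (g ∘ suc) + g zero  ≡⟨ solve 3 (λ a s b → a :+ s :+ b := b :+ s :+ a) refl (f zero) (∑ (g ∘ suc)) (g zero) ⟩
  g zero + ∑ (g ∘ suc) + f zero  ∎
  where open ≡-Reasoning
∑-exchange (suc u) f g f≗g = begin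
  f zero + ∑ (f ∘ suc) + g (suc u)    ≡⟨ +-assoc (f zero) _ _ ⟩
  f zero + (∑ (f ∘ suc) + g (suc u))  ≡⟨ cong₂ _+_ (f≗g zero λ ()) (∑-exchange u (f ∘ suc) (g ∘ suc) λ w w≢u → f≗g (suc w) (w≢u ∘ suc-injective)) ⟩
  g zero + (∑ (g ∘ suc) + f (suc u))  ≡⟨ +-assoc (g zero) _ _ ⟨
  g zero + ∑ (g ∘ suc) + f (suc u)    ∎
  where open ≡-Reasoning

∑-exchange₂ : ∀ {n} {u v : Fin n} (f g : Fin n → ℕ) → u ≢ v → (∀ w → w ≢ u → w ≢ v → f w ≡ g w)
  → ∑ f + (g u + g v) ≡ ∑ g + (f u + f v)
∑-exchange₂ {u = u} {v} f g u≢v f≗g = begin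
  ∑ f + (g u + g v)  ≡⟨ +-assoc (∑ f) _ _ ⟨
  ∑ f + g u + g v    ≡⟨ cong (λ x → ∑ f + x + g v) (updateAt-updates u f) ⟨
  ∑ f + h u + g v    ≡⟨ cong (_+ g v) (∑-exchange u f h f≗h) ⟩
  ∑ h + f u + g v    ≡⟨ solve 3 (λ s a b → s :+ a :+ b := s :+ b :+ a) refl (∑ h) (f u) (g v) ⟩
  ∑ h + g v + f u    ≡⟨ cong (_+ f u) (∑-exchange v h g h≗g) ⟩
  ∑ g + h v + f u    ≡⟨ cong (λ x → ∑ g + x + f u) (updateAt-minimal v u f (u≢v ∘ sym)) ⟩
  ∑ g + f v + f u    ≡⟨ solve 3 (λ s a b → s :+ b :+ a := s :+ (a :+ b)) refl (∑ g) (f u) (f v) ⟩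
  ∑ g + (f u + f v)  ∎
  where
  open ≡-Reasoning
  h : Fin _ → ℕ
  h = updateAt f u (const (g u))
  f≗h : ∀ w → w ≢ u → f w ≡ h w
  f≗h w w≢u = sym (updateAt-minimal w u f w≢u)
  h≗g : ∀ w → w ≢ v → h w ≡ g w
  h≗g w w≢v with w ≟ u
  ... | yes refl = updateAt-updates u f
  ... | no w≢u = trans (updateAt-minimal w u f w≢u) (f≗g w w≢u w≢v)

∑-<-exchange₂ : ∀ {n} {u v : Fin n} (f g : Fin n → ℕ) → u ≢ v → (∀ w → w ≢ u → w ≢ v → f w ≡ g w)
  → f u + f v < g u + g v → ∑ f < ∑ g
∑-<-exchange₂ {u = u} {v} f g u≢v f≗g fuv<guv = +-cancelʳ-< (f u + f v) (∑ f) (∑ g)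
  (subst (∑ f + (f u + f v) <_) (∑-exchange₂ f g u≢v f≗g) (+-monoʳ-< (∑ f) fuv<guv))

spread-squares : ∀ x y k → x + k ≤ y → 0 < k → (x + k) * (x + k) + y * y < x * x + (y + k) * (y + k)
spread-squares x y k x+k≤y (s≤s z≤n) with m≤n⇒∃[o]m+o≡n x+k≤y
... | m , refl = subst (lhs <_) (sym expand) (m<m+n lhs (s≤s z≤n))
  where
  lhs : ℕ
  lhs = (x + k) * (x + k) + (x + k + m) * (x + k + m)
  expand : x * x + (x + k + m + k) * (x + k + m + k) ≡ lhs + 2 * (k * (k + m))
  expand = solve 3 (λ x k m → x :* x :+ (x :+ k :+ m :+ k) :* (x :+ k :+ m :+ k)
    := (x :+ k) :* (x :+ k) :+ (x :+ k :+ m) :* (x :+ k :+ m) :+ con 2 :* (k :* (k :+ m))) refl x k m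

==-refl : ∀ {n} (a : Fin n) → (a == a) ≡ true
==-refl a with a ≟ a
... | yes _   = refl
... | no a≢a = contradiction refl a≢a

==-≢ : ∀ {n} {a b : Fin n} → a ≢ b → (a == b) ≡ false
==-≢ {a = a} {b} a≢b with a ≟ b
... | yes a≡b = contradiction a≡b a≢b
... | no _    = refl

module _ {n : ℕ} (G : Graph n) {x y : Fin n} where

  inN⇒ : ∀ {w} → inN G x y w ≡ true → w ≢ x × w ≢ y × G x w ≡ true × G y w ≡ false
  inN⇒ {w} with w ≟ x | w ≟ y | G x w | G y w
  ... | no w≢x | no w≢y | true  | false = λ _ → w≢x , w≢y , refl , refl
  ... | yes _  | _      | _     | _     = λ ()
  ... | no _   | yes _  | _     | _     = λ ()
  ... | no _   | no _   | false | _     = λ ()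
  ... | no _   | no _   | true  | true  = λ ()

  inN⇐ : ∀ {w} → w ≢ x → w ≢ y → G x w ≡ true → G y w ≡ false → inN G x y w ≡ true
  inN⇐ w≢x w≢y Gxw Gyw rewrite ==-≢ w≢x | ==-≢ w≢y | Gxw | Gyw = refl

deg-∑ : ∀ {n} (G : Graph n) w → deg G w ≡ ∑[ b < n ] 𝟙 (G w b)
deg-∑ {n} G w = sum-map-tabulate n (𝟙 ∘ G w) (λ b → b)

d2-∑ : ∀ {n} (G : Graph n) → d2 G ≡ ∑[ w < n ] (deg G w * deg G w)
d2-∑ {n} G = sum-map-tabulate n (λ w → deg G w * deg G w) (λ w → w)

swap≡∘transpose : ∀ {n} {u v : Fin n} (r : Fin n → Bool) {c : Bool} → c ≡ true → r u ≡ true → r v ≡ false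
  → ∀ b → (if b == u ∧ c then false else if b == v ∧ c then true else r b) ≡ r (transpose u v ⟨$⟩ʳ b)
swap≡∘transpose {u = u} {v} r refl ru rv b with b ≟ u
... | yes refl = sym rv
... | no _ with b ≟ v
...   | yes refl = sym ru
...   | no _     = refl

𝟙-delete : ∀ {c g} → (c ≡ true → g ≡ true) → 𝟙 (if c then false else g) + 𝟙 c ≡ 𝟙 g
𝟙-delete {true}  c⇒g = cong 𝟙 (sym (c⇒g refl))
𝟙-delete {false} _   = +-identityʳ _

𝟙-insert : ∀ {c g} → (c ≡ true → g ≡ false) → 𝟙 (if c then true else g) ≡ 𝟙 g + 𝟙 c
𝟙-insert {true}  c⇒¬g = cong (λ x → 𝟙 x + 1) (sym (c⇒¬g refl))
𝟙-insert {false} _    = sym (+-identityʳ _)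

module Compression {n : ℕ} (G : Graph n) (G-sym : ∀ a b → G a b ≡ G b a) {u v : Fin n} (u≢v : u ≢ v) where

  ∣N∣ : ℕ
  ∣N∣ = ∑[ b < n ] 𝟙 (inN G u v b)

  row-source : ∀ b → compress G u v u b ≡ (if inN G u v b then false else G u b)
  row-source b rewrite ==-refl u | ==-≢ u≢v | ∧-zeroʳ (b == u) | ∧-zeroʳ (b == v)
                     | ∨-identityʳ (inN G u v b) = refl

  row-target : ∀ b → compress G u v v b ≡ (if inN G u v b then true else G v b)
  row-target b rewrite ==-refl v | ==-≢ (u≢v ∘ sym) | ∧-zeroʳ (b == u) | ∧-zeroʳ (b == v)
                     | ∨-identityʳ (inN G u v b) = refl

  module _ {w : Fin n} (w≢u : w ≢ u) (w≢v : w ≢ v) where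

    row-other : ∀ b → compress G u v w b
      ≡ (if b == u ∧ inN G u v w then false else if b == v ∧ inN G u v w then true else G w b)
    row-other b rewrite ==-≢ w≢u | ==-≢ w≢v = refl

    row-unmoved : inN G u v w ≡ false → ∀ b → compress G u v w b ≡ G w b
    row-unmoved w∉N b rewrite row-other b | w∉N | ∧-zeroʳ (b == u) | ∧-zeroʳ (b == v) = refl

    row-moved : inN G u v w ≡ true → ∀ b → compress G u v w b ≡ G w (transpose u v ⟨$⟩ʳ b)
    row-moved w∈N b = trans (row-other b) (swap≡∘transpose (G w) w∈N (trans (G-sym w u) Guw) (trans (G-sym w v) Gvw) b)
      where
      Guw : G u w ≡ true
      Guw = proj₁ (proj₂ (proj₂ (inN⇒ G w∈N)))
      Gvw : G v w ≡ false
      Gvw = proj₂ (proj₂ (proj₂ (inN⇒ G w∈N)))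

    row-count : ∀ {c} → inN G u v w ≡ c → ∑[ b < n ] 𝟙 (compress G u v w b) ≡ ∑[ b < n ] 𝟙 (G w b)
    row-count {false} w∉N = sum-cong-≗ (cong 𝟙 ∘ row-unmoved w∉N)
    row-count {true}  w∈N = trans (sum-cong-≗ (cong 𝟙 ∘ row-moved w∈N)) (sym (∑-permute (𝟙 ∘ G w) (transpose u v)))

    deg-other : deg (compress G u v) w ≡ deg G w
    deg-other = trans (deg-∑ (compress G u v) w) (trans (row-count refl) (sym (deg-∑ G w)))

  deg-source : deg (compress G u v) u + ∣N∣ ≡ deg G u
  deg-source = begin
    deg (compress G u v) u + ∣N∣                              ≡⟨ cong (_+ ∣N∣) (deg-∑ (compress G u v) u) ⟩
    ∑[ b < n ] 𝟙 (compress G u v u b) + ∣N∣                    ≡⟨ ∑-distrib-+ (𝟙 ∘ compress G u v u) (𝟙 ∘ inN G u v) ⟨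
    ∑[ b < n ] (𝟙 (compress G u v u b) + 𝟙 (inN G u v b))     ≡⟨ sum-cong-≗ deleted ⟩
    ∑[ b < n ] 𝟙 (G u b)                                       ≡⟨ deg-∑ G u ⟨
    deg G u                                                    ∎
    where
    open ≡-Reasoning
    deleted : ∀ b → 𝟙 (compress G u v u b) + 𝟙 (inN G u v b) ≡ 𝟙 (G u b)
    deleted b = trans (cong (λ e → 𝟙 e + 𝟙 (inN G u v b)) (row-source b)) (𝟙-delete (proj₁ ∘ proj₂ ∘ proj₂ ∘ inN⇒ G))

  deg-target : deg (compress G u v) v ≡ deg G v + ∣N∣
  deg-target = begin
    deg (compress G u v) v                          ≡⟨ deg-∑ (compress G u v) v ⟩
    ∑[ b < n ] 𝟙 (compress G u v v b)               ≡⟨ sum-cong-≗ inserted ⟩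
    ∑[ b < n ] (𝟙 (G v b) + 𝟙 (inN G u v b))        ≡⟨ ∑-distrib-+ (𝟙 ∘ G v) (𝟙 ∘ inN G u v) ⟩
    ∑[ b < n ] 𝟙 (G v b) + ∣N∣                      ≡⟨ cong (_+ ∣N∣) (deg-∑ G v) ⟨
    deg G v + ∣N∣                                   ∎
    where
    open ≡-Reasoning
    inserted : ∀ b → 𝟙 (compress G u v v b) ≡ 𝟙 (G v b) + 𝟙 (inN G u v b)
    inserted b = trans (cong 𝟙 (row-target b)) (𝟙-insert (proj₂ ∘ proj₂ ∘ proj₂ ∘ inN⇒ G))

  ∣N∣>0 : ∃ (λ a → inN G u v a ≡ true) → 0 < ∣N∣
  ∣N∣>0 (a , a∈N) = subst (_≤ ∣N∣) (cong 𝟙 a∈N) (term≤∑ (𝟙 ∘ inN G u v) a)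

  d2-compress-< : ∃ (λ a → inN G u v a ≡ true) → deg G u ≤ deg G v → d2 G < d2 (compress G u v)
  d2-compress-< N≢∅ du≤dv rewrite d2-∑ G | d2-∑ (compress G u v) =
    ∑-<-exchange₂ (λ w → deg G w * deg G w) (λ w → deg (compress G u v) w * deg (compress G u v) w) u≢v
      (λ w w≢u w≢v → cong (λ d → d * d) (sym (deg-other w≢u w≢v))) spread
    where
    spread : deg G u * deg G u + deg G v * deg G v
           < deg (compress G u v) u * deg (compress G u v) u + deg (compress G u v) v * deg (compress G u v) v
    spread = subst₂ (λ du dv′ → du * du + deg G v * deg G v < deg (compress G u v) u * deg (compress G u v) u + dv′ * dv′)
      deg-source (sym deg-target)
      (spread-squares _ _ _ (subst (_≤ deg G v) (sym deg-source) du≤dv) (∣N∣>0 N≢∅))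

NbhdSub⊎witness : ∀ {n} (G : Graph n) u v → NbhdSub G u v ⊎ ∃ λ a → G u a ≡ true × G v a ≡ false
NbhdSub⊎witness G u v with any? (λ a → (G u a ≟ᵇ true) ×-dec (G v a ≟ᵇ false))
... | yes witness = inj₂ witness
... | no ∄witness = inj₁ u⊆v
  where
  u⊆v : NbhdSub G u v
  u⊆v a Gua with G v a in Gva
  ... | true  = refl
  ... | false = contradiction (a , Gua , Gva) ∄witness

corollary2p7 : (n : ℕ) (X : Fin n → Bool) (𝒢 : Graph n → Set)
    → (∀ (G' : Graph n) → 𝒢 G' → BipartiteWith X G')
    → (∀ (G' : Graph n) (u v : Fin n) → 𝒢 G' → X u ≡ true → X v ≡ true → 𝒢 (compress G' u v))
    → (G : Graph n) → 𝒢 G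
    → (∀ (G' : Graph n) → 𝒢 G' → d2 G' ≤ d2 G)
    → ThresholdBipartite G
corollary2p7 n X 𝒢 bipartite closed G G∈𝒢 maximal = X , crossing , nested
  where
  open Σ (bipartite G G∈𝒢) renaming (proj₁ to simple; proj₂ to crossing)

  private-neighbour : ∀ {u v a} → X u ≡ true → X v ≡ true → G u a ≡ true → G v a ≡ false
    → u ≢ v × inN G u v a ≡ true
  private-neighbour {u} {v} {a} Xu Xv Gua Gva = u≢v , inN⇐ G a≢u a≢v Gua Gva
    where
    u≢v : u ≢ v
    u≢v refl = contradiction (trans (sym Gua) Gva) λ ()
    a≢u : a ≢ u
    a≢u refl = contradiction (trans (sym Gua) (proj₂ simple a)) λ ()
    a≢v : a ≢ v
    a≢v refl = crossing u a Gua (trans Xu (sym Xv))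

  degree-drops : ∀ {u v a} → X u ≡ true → X v ≡ true → G u a ≡ true → G v a ≡ false → deg G v < deg G u
  degree-drops {u} {v} {a} Xu Xv Gua Gva with private-neighbour Xu Xv Gua Gva
  ... | u≢v , a∈N = ≰⇒> λ du≤dv →
    <⇒≱ (Compression.d2-compress-< G (proj₁ simple) u≢v (a , a∈N) du≤dv) (maximal _ (closed G u v G∈𝒢 Xu Xv))

  nested : ∀ u v → X u ≡ true → X v ≡ true → NbhdSub G u v ⊎ NbhdSub G v u
  nested u v Xu Xv with NbhdSub⊎witness G u v | NbhdSub⊎witness G v u
  ... | inj₁ u⊆v | _        = inj₁ u⊆v
  ... | inj₂ _   | inj₁ v⊆u = inj₂ v⊆u
  ... | inj₂ (a , Gua , Gva) | inj₂ (b , Gvb , Gub) =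
    contradiction (degree-drops Xu Xv Gua Gva) (<-asym (degree-drops Xv Xu Gvb Gub))
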